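{- Let $d\ge 8$. Let $P_d$ be the graph obtained from $K_{d+1}$ by deleting the edges of three pairwise vertex-disjoint paths of length 2, and then deleting the edges of a maximum matching on the $d-8$ vertices not lying on these paths. Then $P_d$ is a $d$-pod.
   Context: A graph $H$ is immersed in a multigraph $G$ if there is an injection $\phi:V(H)\to V(G)$ and an assignment to each edge $uv\in E(H)$ of a path in $G$ between $\phi(u)$ and $\phi(v)$ with paths of distinct edges pairwise edge-disjoint. For a positive integer $d$, a $d$-pod is a simple graph in which every vertex has degree at least $d-2$ and at most $d-2$ vertices have degree exactly $d-2$, and such that, letting $A$ be its set of vertices of degree exactly $d-2$, for every maximum matching on $A$ (i.e. $\lfloor |A|/2\rfloor$ pairwise disjoint pairs of vertices of $A$), the multigraph obtained by adding one new edge joining each chosen pair (parallel edges allowed) has no immersion of $K_d$. -}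

module Defs where

open import Data.Bool using (Bool; true; false; not; _∧_; _∨_; if_then_else_; T)
open import Data.Bool.Properties using (∨-comm)
open import Data.Nat using (ℕ; zero; suc; _∸_; _≤_; _/_; _%_; _≡ᵇ_; _<ᵇ_; _≤ᵇ_)
open import Data.Fin using (Fin; toℕ; _<_)
open import Data.List using (_++_; List; []; _∷_; length; lookup; concatMap; map; allFin)
open import Data.Nat.ListAction using (sum)
open import Data.List.Membership.Propositional using (_∈_)
open import Data.List.Relation.Unary.Unique.Propositional using (Unique)
open import Data.Product using (_×_; _,_)
open import Data.Sum using (_⊎_)
open import Data.Empty using (⊥)
open import Function.Definitions using (Injective)
open import Relation.Binary.PropositionalEquality using (_≡_; refl; cong; cong₂)
open import Relation.Nullary using (¬_)

record SimpleGraph (n : ℕ) : Set where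
  field
    adj    : Fin n → Fin n → Bool
    sym    : ∀ a b → adj a b ≡ adj b a
    irrefl : ∀ a → adj a a ≡ false
open SimpleGraph public

deg : ∀ {n} → SimpleGraph n → Fin n → ℕ
deg {n} G v = sum (map (λ u → if adj G v u then 1 else 0) (allFin n))

edgeList : ∀ {n} → SimpleGraph n → List (Fin n × Fin n)
edgeList {n} G =
  concatMap (λ a → concatMap (λ b →
      if (toℕ a <ᵇ toℕ b) ∧ adj G a b then (a , b) ∷ [] else [])
    (allFin n)) (allFin n)

-- Multigraphs on Fin n: a list of edges (parallel edges allowed);
-- the edges are the positions Fin (length E) of the list.

Multigraph : ℕ → Set
Multigraph n = List (Fin n × Fin n)

toMulti : ∀ {n} → SimpleGraph n → Multigraph n
toMulti = edgeList

Joins : ∀ {n} → Fin n × Fin n → Fin n → Fin n → Set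
Joins (p , q) x z = (p ≡ x × q ≡ z) ⊎ (p ≡ z × q ≡ x)

-- Walk E x y es vs : a walk in E from x to y using the edges es
-- (in order) and visiting the vertices vs (in order)
data Walk {n} (E : Multigraph n) : Fin n → Fin n → List (Fin (length E)) → List (Fin n) → Set where
  nil  : ∀ {x} → Walk E x x [] (x ∷ [])
  cons : ∀ {x y z es vs} (i : Fin (length E)) →
         Joins (lookup E i) x z → Walk E z y es vs → Walk E x y (i ∷ es) (x ∷ vs)

record Immersion {k n} (H : SimpleGraph k) (E : Multigraph n) : Set where
  field
    φ      : Fin k → Fin n
    φ-inj  : Injective _≡_ _≡_ φ
    route  : (a b : Fin k) → a < b → T (adj H a b) → List (Fin (length E))
    verts  : (a b : Fin k) → a < b → T (adj H a b) → List (Fin n)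
    isWalk : ∀ a b (p : a < b) (q : T (adj H a b)) →
             Walk E (φ a) (φ b) (route a b p q) (verts a b p q)
    isPath : ∀ a b (p : a < b) (q : T (adj H a b)) → Unique (verts a b p q)
    disjoint : ∀ a b a' b' (p : a < b) (q : T (adj H a b))
                 (p' : a' < b') (q' : T (adj H a' b')) →
               ¬ (a ≡ a' × b ≡ b') →
               ∀ i → i ∈ route a b p q → i ∈ route a' b' p' q' → ⊥

_immersedIn_ : ∀ {k n} → SimpleGraph k → Multigraph n → Set
H immersedIn E = Immersion H E

≡ᵇ-sym : ∀ m n → (m ≡ᵇ n) ≡ (n ≡ᵇ m)
≡ᵇ-sym zero zero = refl
≡ᵇ-sym zero (suc n) = refl
≡ᵇ-sym (suc m) zero = refl
≡ᵇ-sym (suc m) (suc n) = ≡ᵇ-sym m n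

≡ᵇ-refl : ∀ m → (m ≡ᵇ m) ≡ true
≡ᵇ-refl zero = refl
≡ᵇ-refl (suc m) = ≡ᵇ-refl m

K : (d : ℕ) → SimpleGraph d
K d = record
  { adj    = λ a b → not (toℕ a ≡ᵇ toℕ b)
  ; sym    = λ a b → cong not (≡ᵇ-sym (toℕ a) (toℕ b))
  ; irrefl = λ a → cong not (≡ᵇ-refl (toℕ a)) }

InA : ∀ {n} → ℕ → SimpleGraph n → Fin n → Set
InA d G v = deg G v ≡ d ∸ 2

countA : ∀ {n} → ℕ → SimpleGraph n → ℕ
countA {n} d G = sum (map (λ v → if deg G v ≡ᵇ (d ∸ 2) then 1 else 0) (allFin n))

pairVerts : ∀ {n} → List (Fin n × Fin n) → List (Fin n)
pairVerts = concatMap (λ { (a , b) → a ∷ b ∷ [] })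

-- a maximum matching on A: ⌊|A|/2⌋ pairwise disjoint pairs of vertices of A
record MaxMatchingOnA {n} (d : ℕ) (G : SimpleGraph n) (M : List (Fin n × Fin n)) : Set where
  field
    size     : length M ≡ countA d G / 2
    inA      : ∀ a b → (a , b) ∈ M → InA d G a × InA d G b
    disjoint : Unique (pairVerts M)

addPairs : ∀ {n} → SimpleGraph n → List (Fin n × Fin n) → Multigraph n
addPairs G M = toMulti G ++ M

record IsPod {n} (d : ℕ) (G : SimpleGraph n) : Set where
  field
    minDeg   : ∀ v → d ∸ 2 ≤ deg G v
    fewA     : countA d G ≤ d ∸ 2
    noImm    : ∀ M → MaxMatchingOnA d G M → ¬ (K d immersedIn addPairs G M)

-- The three paths of length 2 are 0-1-2, 3-4-5, 6-7-8 (middle vertices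
-- 1, 4, 7); the remaining d - 8 vertices 9, …, d are matched by the
-- maximum matching {9,10}, {11,12}, … .

removedR : ℕ → ℕ → Bool
removedR a b =
  ((a <ᵇ 9) ∧ (b <ᵇ 9) ∧ ((a / 3) ≡ᵇ (b / 3)) ∧ ((a % 3) ≡ᵇ 1))
  ∨ ((9 ≤ᵇ a) ∧ (9 ≤ᵇ b) ∧ (((a ∸ 9) / 2) ≡ᵇ ((b ∸ 9) / 2)))

removed : ℕ → ℕ → Bool
removed a b = removedR a b ∨ removedR b a

P : (d : ℕ) → SimpleGraph (suc d)
P d = record
  { adj    = λ a b → not (toℕ a ≡ᵇ toℕ b) ∧ not (removed (toℕ a) (toℕ b))
  ; sym    = λ a b → cong₂ (λ x y → not x ∧ not y) (≡ᵇ-sym (toℕ a) (toℕ b))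
                       (∨-comm (removedR (toℕ a) (toℕ b)) (removedR (toℕ b) (toℕ a)))
  ; irrefl = λ a → cong (λ x → not x ∧ not (removed (toℕ a) (toℕ a))) (≡ᵇ-refl (toℕ a)) }

module Submission where

-- A vertex misses only the vertices listed in coNbrs, so every
-- degree is at least d - 2; the middle vertices 1, 4, 7 have degree exactly
-- d - 2 and all others more. Hence A = {1, 4, 7} and a maximum matching on A
-- is a single pair pq of middle vertices.
--
-- Suppose K_d immerses in E = P_d + pq and let w be the third
-- middle vertex. A branch vertex meets its d - 1 routes in distinct edges, so
-- w (degree d - 2) is the only vertex that is not a branch vertex. As E has
-- maximum degree d, no route passes through a branch vertex (it would need
-- d + 1 edges there). So the route of every non-edge of P_d avoiding w,
-- other than pq, passes through w and uses two edges at w. These routes are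
-- edge-disjoint and there are 4 + ⌊(d - 8)/2⌋ of them: more than w can carry.

open import Defs hiding (sym)
open import Data.Bool using (Bool; true; false; not; _∧_; _∨_; if_then_else_; T)
open import Data.Bool.Properties using (∧-identityʳ; ∧-zeroʳ; ∨-comm; T-∧; T-∨)
open import Data.Nat using (ℕ; zero; suc; _+_; _*_; _∸_; _≤_; _<_; z≤n; s≤s; s≤s⁻¹; _≡ᵇ_; _<ᵇ_; _/_; _%_)
import Data.Nat.Properties as ℕ
import Data.Nat.DivMod as ℕ
open import Data.Nat.Divisibility using (divides-refl)
open import Data.Nat.ListAction using (sum)
open import Data.Nat.ListAction.Properties using (sum-++)
open import Data.Nat.Tactic.RingSolver using (solve-∀)
open import Data.Fin using (Fin; toℕ; fromℕ<; punchIn; punchOut) renaming (suc to fsuc; _<_ to _<ᶠ_)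
import Data.Fin.Properties as Fin
open import Data.List using (List; []; _∷_; map; length; lookup; allFin; tabulate; upTo; applyUpTo; _++_; concatMap)
import Data.List.Properties as List
open import Data.List.Membership.Propositional using (_∈_; _∉_)
open import Data.List.Membership.Propositional.Properties using (∈-allFin; ∈-upTo⁺; ∈-++⁻; ∈-map⁻; ∈-concatMap⁻; ∈-lookup)
open import Data.List.Membership.DecPropositional ℕ._≟_ using (_∈?_)
open import Data.List.Relation.Unary.Any using (here; there; satisfied)
open import Data.List.Relation.Unary.All using (All; []; _∷_; all?)
import Data.List.Relation.Unary.All as All
import Data.List.Relation.Unary.All.Properties as All
open import Data.List.Relation.Unary.AllPairs using (AllPairs; []; _∷_)
open import Data.List.Relation.Unary.Unique.Propositional using (Unique)
import Data.List.Relation.Unary.Unique.Propositional.Properties as Unique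
open import Data.List.Relation.Unary.Unique.DecPropositional ℕ._≟_ using (unique?)
open import Data.Product using (Σ; ∃; _×_; _,_; proj₁; proj₂)
open import Data.Sum using (_⊎_; inj₁; inj₂; swap)
open import Data.Empty using (⊥; ⊥-elim)
open import Function using (_∘_; case_of_; Equivalence)
open import Relation.Nullary using (¬_; Dec; yes; no; does)
open import Relation.Nullary.Decidable using (T?; ¬?; _⊎-dec_; _×-dec_; from-yes)
open import Relation.Binary.Definitions using (DecidableEquality; tri<; tri≈; tri>)
open import Relation.Binary.PropositionalEquality
open import Algebra.Properties.CommutativeSemigroup ℕ.+-commutativeSemigroup using (interchange)

ind : Bool → ℕ
ind b = if b then 1 else 0

ind≤1 : ∀ b → ind b ≤ 1
ind≤1 true  = s≤s z≤n
ind≤1 false = z≤n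

T-not⇒¬T : ∀ {b} → T (not b) → ¬ T b
T-not⇒¬T {false} _ ()

¬T⇒T-not : ∀ {b} → ¬ T b → T (not b)
¬T⇒T-not {false} _  = _
¬T⇒T-not {true}  ¬t = ¬t _

sumOver : {A : Set} → (A → ℕ) → List A → ℕ
sumOver f xs = sum (map f xs)

count : {A : Set} → (A → Bool) → List A → ℕ
count p = sumOver (ind ∘ p)

module _ {A : Set} where

  sumOver-mono : ∀ {f g : A → ℕ} → (∀ x → f x ≤ g x) → ∀ xs → sumOver f xs ≤ sumOver g xs
  sumOver-mono f≤g []       = z≤n
  sumOver-mono f≤g (x ∷ xs) = ℕ.+-mono-≤ (f≤g x) (sumOver-mono f≤g xs)

  sumOver-cong : ∀ {f g : A → ℕ} → (∀ x → f x ≡ g x) → ∀ xs → sumOver f xs ≡ sumOver g xs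
  sumOver-cong f≡g []       = refl
  sumOver-cong f≡g (x ∷ xs) = cong₂ _+_ (f≡g x) (sumOver-cong f≡g xs)

  sumOver-+ : ∀ (f g : A → ℕ) xs → sumOver (λ x → f x + g x) xs ≡ sumOver f xs + sumOver g xs
  sumOver-+ f g []       = refl
  sumOver-+ f g (x ∷ xs) =
    trans (cong (f x + g x +_) (sumOver-+ f g xs)) (interchange (f x) (g x) (sumOver f xs) (sumOver g xs))

  sumOver-map : ∀ {B : Set} (f : A → ℕ) (g : B → A) xs → sumOver f (map g xs) ≡ sumOver (f ∘ g) xs
  sumOver-map f g xs = cong sum (sym (List.map-∘ xs))

  sumOver-if : ∀ (c : Bool) (f : A → ℕ) xs → sumOver (λ x → if c then f x else 0) xs ≡ (if c then sumOver f xs else 0)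
  sumOver-if true  f xs       = refl
  sumOver-if false f []       = refl
  sumOver-if false f (x ∷ xs) = sumOver-if false f xs

  sumOver-++ : ∀ (f : A → ℕ) xs ys → sumOver f (xs ++ ys) ≡ sumOver f xs + sumOver f ys
  sumOver-++ f xs ys = trans (cong sum (List.map-++ f xs ys)) (sum-++ (map f xs) (map f ys))

  sumOver-concatMap : ∀ {B : Set} (f : A → ℕ) (g : B → List A) bs →
                      sumOver f (concatMap g bs) ≡ sumOver (sumOver f ∘ g) bs
  sumOver-concatMap f g []       = refl
  sumOver-concatMap f g (b ∷ bs) = trans (sumOver-++ f (g b) (concatMap g bs)) (cong (sumOver f (g b) +_) (sumOver-concatMap f g bs))

  count-complement : ∀ (p : A → Bool) xs → count p xs + count (not ∘ p) xs ≡ length xs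
  count-complement p []       = refl
  count-complement p (x ∷ xs) with p x
  ... | true  = cong suc (count-complement p xs)
  ... | false = trans (ℕ.+-suc (count p xs) _) (cong suc (count-complement p xs))

  count-none : ∀ (p : A → Bool) {xs} → (∀ {x} → x ∈ xs → ¬ T (p x)) → count p xs ≡ 0
  count-none p {[]}     none = refl
  count-none p {x ∷ xs} none with p x in px
  ... | true  = ⊥-elim (none (here refl) (subst T (sym px) _))
  ... | false = count-none p (none ∘ there)

module DecCounting {A : Set} (_≟_ : DecidableEquality A) where

  _==_ : A → A → Bool
  x == y = does (x ≟ y)

  ==-refl : ∀ x → T (x == x)
  ==-refl x with x ≟ x
  ... | yes _   = _
  ... | no x≢x  = x≢x refl

  ==⇒≡ : ∀ {x y} → T (x == y) → x ≡ y
  ==⇒≡ {x} {y} t with x ≟ y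
  ... | yes x≡y = x≡y

  _without_ : (A → Bool) → A → A → Bool
  (p without y) x = p x ∧ not (x == y)

  without-intro : ∀ {p : A → Bool} {x y} → T (p x) → x ≢ y → T ((p without y) x)
  without-intro {p} {x} {y} px x≢y with x ≟ y
  ... | yes x≡y = ⊥-elim (x≢y x≡y)
  ... | no _    = subst T (sym (∧-identityʳ (p x))) px

  without-elim : ∀ {p : A → Bool} {x y} → T ((p without y) x) → T (p x) × x ≢ y
  without-elim {p} {x} {y} t with x ≟ y
  ... | yes _   = ⊥-elim (subst T (∧-zeroʳ (p x)) t)
  ... | no x≢y  = subst T (∧-identityʳ (p x)) t , x≢y

  count-single-≥ : ∀ {y dom} → y ∈ dom → 1 ≤ count (_== y) dom
  count-single-≥ {y} (here refl) with y ≟ y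
  ... | yes _  = s≤s z≤n
  ... | no y≢y = ⊥-elim (y≢y refl)
  count-single-≥ {y} {x ∷ _} (there y∈) = ℕ.≤-trans (count-single-≥ y∈) (ℕ.m≤n+m _ (ind (x == y)))

  count-single-≤ : ∀ y {dom} → Unique dom → count (_== y) dom ≤ 1
  count-single-≤ y {[]}      []            = z≤n
  count-single-≤ y {x ∷ dom} (x∉ ∷ unique) with x ≟ y
  ... | no _     = count-single-≤ y unique
  ... | yes refl = ℕ.≤-reflexive (cong suc (count-none (_== y) y∉dom))
    where
    y∉dom : ∀ {z} → z ∈ dom → ¬ T (z == y)
    y∉dom {z} z∈ t with z ≟ y
    ... | yes refl = All.lookup x∉ z∈ refl

  split-at : ∀ (p : A → Bool) {y} → T (p y) → ∀ x → ind (x == y) + ind ((p without y) x) ≡ ind (p x)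
  split-at p {y} py x with x ≟ y
  ... | yes refl rewrite ∧-zeroʳ (p x) with p x
  ...   | true = refl
  split-at p {y} () x | yes refl | false
  split-at p {y} py x | no _ rewrite ∧-identityʳ (p x) = refl

  split-≤ : ∀ (p : A → Bool) y x → ind (p x) ≤ ind (x == y) + ind ((p without y) x)
  split-≤ p y x with x ≟ y
  ... | yes refl = ℕ.≤-trans (ind≤1 (p x)) (ℕ.m≤m+n 1 _)
  ... | no _     = ℕ.≤-reflexive (cong ind (sym (∧-identityʳ (p x))))

  unique⇒≤count : ∀ (p : A → Bool) dom {xs} → Unique xs →
                  (∀ {x} → x ∈ xs → x ∈ dom × T (p x)) → length xs ≤ count p dom
  unique⇒≤count p dom {[]}     []            _    = z≤n
  unique⇒≤count p dom {y ∷ xs} (y∉ ∷ unique) good = begin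
    1 + length xs                                          ≤⟨ ℕ.+-mono-≤ (count-single-≥ (proj₁ (good (here refl)))) rest ⟩
    count (_== y) dom + count (p without y) dom            ≡⟨ sumOver-+ (ind ∘ (_== y)) (ind ∘ (p without y)) dom ⟨
    sumOver (λ x → ind (x == y) + ind ((p without y) x)) dom ≡⟨ sumOver-cong (split-at p (proj₂ (good (here refl)))) dom ⟩
    count p dom                                            ∎
    where
    open ℕ.≤-Reasoning
    rest : length xs ≤ count (p without y) dom
    rest = unique⇒≤count (p without y) dom unique λ {x} x∈ →
      let (x∈dom , px) = good (there x∈) in
      x∈dom , without-intro {p} px (λ { refl → All.lookup y∉ x∈ refl })

  count≤cover : ∀ (p : A → Bool) {dom} → Unique dom → ∀ ws →
                (∀ {x} → x ∈ dom → T (p x) → x ∈ ws) → count p dom ≤ length ws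
  count≤cover p {dom} unique []       cover = ℕ.≤-reflexive (count-none p (λ x∈ px → case cover x∈ px of λ ()))
  count≤cover p {dom} unique (y ∷ ws) cover = begin
    count p dom                                            ≤⟨ sumOver-mono (split-≤ p y) dom ⟩
    sumOver (λ x → ind (x == y) + ind ((p without y) x)) dom ≡⟨ sumOver-+ (ind ∘ (_== y)) (ind ∘ (p without y)) dom ⟩
    count (_== y) dom + count (p without y) dom            ≤⟨ ℕ.+-mono-≤ (count-single-≤ y unique) rest ⟩
    1 + length ws                                          ∎
    where
    open ℕ.≤-Reasoning
    rest : count (p without y) dom ≤ length ws
    rest = count≤cover (p without y) unique ws λ x∈ t →
      let (px , x≢y) = without-elim {p} t in
      case cover x∈ px of λ where
        (here x≡y)  → ⊥-elim (x≢y x≡y)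
        (there x∈ws) → x∈ws

  sumOver-δ : ∀ {y dom} → Unique dom → y ∈ dom → ∀ k → sumOver (λ x → if x == y then k else 0) dom ≡ k
  sumOver-δ {y} {x ∷ dom} (x∉ ∷ unique) y∈ k with x ≟ y | y∈
  ... | yes refl | _          = trans (cong (k +_) (sumOver-zero dom λ z∈ → All.lookup x∉ z∈)) (ℕ.+-identityʳ k)
    where
    sumOver-zero : ∀ zs → (∀ {z} → z ∈ zs → x ≢ z) → sumOver (λ z → if z == x then k else 0) zs ≡ 0
    sumOver-zero []       _ = refl
    sumOver-zero (z ∷ zs) x∉zs with z ≟ x
    ... | yes refl = ⊥-elim (x∉zs (here refl) refl)
    ... | no _     = sumOver-zero zs (x∉zs ∘ there)
  ... | no x≢y   | here y≡x   = ⊥-elim (x≢y (sym y≡x))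
  ... | no _     | there y∈′  = sumOver-δ unique y∈′ k

module _ {n : ℕ} where

  open DecCounting (Fin._≟_ {n})

  inc : Fin n → Fin n × Fin n → Bool
  inc v (a , b) = (a == v) ∨ (b == v)

  degE : Fin n → Multigraph n → ℕ
  degE v = count (inc v)

  degE-++ : ∀ v (E E′ : Multigraph n) → degE v (E ++ E′) ≡ degE v E + degE v E′
  degE-++ v = sumOver-++ (ind ∘ inc v)

  inc-ends : ∀ {v a b} → T (inc v (a , b)) → a ≡ v ⊎ b ≡ v
  inc-ends {v} {a} {b} t with Equivalence.to (T-∨ {a == v}) t
  ... | inj₁ a=v = inj₁ (==⇒≡ a=v)
  ... | inj₂ b=v = inj₂ (==⇒≡ b=v)

  edgesAt-≤ : ∀ (E : Multigraph n) v {is : List (Fin (length E))} → Unique is →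
              (∀ {i} → i ∈ is → T (inc v (lookup E i))) → length is ≤ degE v E
  edgesAt-≤ E v distinct incident = subst (_ ≤_) byPosition
    (DecCounting.unique⇒≤count Fin._≟_ (inc v ∘ lookup E) (allFin (length E)) distinct (λ i∈ → ∈-allFin _ , incident i∈))
    where
    byPosition : count (inc v ∘ lookup E) (allFin (length E)) ≡ degE v E
    byPosition = trans (sym (sumOver-map (ind ∘ inc v) (lookup E) (allFin (length E))))
      (cong (sumOver (ind ∘ inc v)) (trans (List.map-tabulate (λ i → i) (lookup E)) (List.tabulate-lookup E)))

  module _ (G : SimpleGraph n) where

    listed : Fin n → Fin n → Bool
    listed a b = (toℕ a <ᵇ toℕ b) ∧ adj G a b

    entry : Fin n → Fin n → List (Fin n × Fin n)
    entry a b = if listed a b then (a , b) ∷ [] else []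

    edgeList-adj : ∀ {e} → e ∈ edgeList G → T (adj G (proj₁ e) (proj₂ e))
    edgeList-adj e∈ with satisfied (∈-concatMap⁻ (λ a → concatMap (entry a) (allFin n)) {xs = allFin n} e∈)
    ... | a , e∈row with satisfied (∈-concatMap⁻ (entry a) {xs = allFin n} e∈row)
    ...   | b , e∈entry = entry-adj a b e∈entry
      where
      entry-adj : ∀ a b {e} → e ∈ entry a b → T (adj G (proj₁ e) (proj₂ e))
      entry-adj a b e∈ with listed a b in listed-ab | e∈
      ... | true | here refl = proj₂ (Equivalence.to T-∧ (subst T (sym listed-ab) _))

    module _ (v : Fin n) where

      entry-bound : ∀ a b → degE v (entry a b) ≤
                    (if a == v then ind (listed v b) else 0) + (if b == v then ind (listed a v) else 0)
      entry-bound a b with listed a b in listed-ab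
      ... | false = z≤n
      ... | true with a Fin.≟ v | b Fin.≟ v
      ...   | yes refl | _        rewrite listed-ab = s≤s z≤n
      ...   | no _     | yes refl rewrite listed-ab = s≤s z≤n
      ...   | no _     | no _     = z≤n

      listed-once : ∀ u → ind (listed v u) + ind (listed u v) ≤ ind (adj G v u)
      listed-once u rewrite SimpleGraph.sym G u v with adj G v u
      ... | false rewrite ∧-zeroʳ (toℕ v <ᵇ toℕ u) | ∧-zeroʳ (toℕ u <ᵇ toℕ v) = z≤n
      ... | true  rewrite ∧-identityʳ (toℕ v <ᵇ toℕ u) | ∧-identityʳ (toℕ u <ᵇ toℕ v)
                  with toℕ v <ᵇ toℕ u in v<u | toℕ u <ᵇ toℕ v in u<v
      ...   | true  | true  = ⊥-elim (ℕ.<-asym (ℕ.<ᵇ⇒< (toℕ v) (toℕ u) (subst T (sym v<u) _)) (ℕ.<ᵇ⇒< (toℕ u) (toℕ v) (subst T (sym u<v) _)))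
      ...   | true  | false = s≤s z≤n
      ...   | false | true  = s≤s z≤n
      ...   | false | false = z≤n

      edgeList-degree : degE v (edgeList G) ≤ deg G v
      edgeList-degree = begin
        degE v (edgeList G)
          ≡⟨ sumOver-concatMap (ind ∘ inc v) (λ a → concatMap (entry a) vs) vs ⟩
        sumOver (λ a → sumOver (ind ∘ inc v) (concatMap (entry a) vs)) vs
          ≡⟨ sumOver-cong (λ a → sumOver-concatMap (ind ∘ inc v) (entry a) vs) vs ⟩
        sumOver (λ a → sumOver (λ b → degE v (entry a b)) vs) vs
          ≤⟨ sumOver-mono (λ a → sumOver-mono (entry-bound a) vs) vs ⟩
        sumOver (λ a → sumOver (λ b → first a b + second a b) vs) vs
          ≡⟨ sumOver-cong (λ a → sumOver-+ (first a) (second a) vs) vs ⟩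
        sumOver (λ a → sumOver (first a) vs + sumOver (second a) vs) vs
          ≡⟨ sumOver-+ (λ a → sumOver (first a) vs) (λ a → sumOver (second a) vs) vs ⟩
        sumOver (λ a → sumOver (first a) vs) vs + sumOver (λ a → sumOver (second a) vs) vs
          ≡⟨ cong₂ _+_ firsts seconds ⟩
        sumOver (λ u → ind (listed v u)) vs + sumOver (λ u → ind (listed u v)) vs
          ≡⟨ sumOver-+ (λ u → ind (listed v u)) (λ u → ind (listed u v)) vs ⟨
        sumOver (λ u → ind (listed v u) + ind (listed u v)) vs
          ≤⟨ sumOver-mono listed-once vs ⟩
        deg G v ∎
        where
        open ℕ.≤-Reasoning
        vs : List (Fin n)
        vs = allFin n
        first second : Fin n → Fin n → ℕ
        first  a b = if a == v then ind (listed v b) else 0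
        second a b = if b == v then ind (listed a v) else 0
        firsts : sumOver (λ a → sumOver (first a) vs) vs ≡ sumOver (λ u → ind (listed v u)) vs
        firsts = trans (sumOver-cong (λ a → sumOver-if (a == v) (λ b → ind (listed v b)) vs) vs)
                       (sumOver-δ (Unique.allFin⁺ n) (∈-allFin v) _)
        seconds : sumOver (λ a → sumOver (second a) vs) vs ≡ sumOver (λ u → ind (listed u v)) vs
        seconds = sumOver-cong (λ a → sumOver-δ (Unique.allFin⁺ n) (∈-allFin v) _) vs

  joins-inc₁ : ∀ {e : Fin n × Fin n} {x z} → Joins e x z → T (inc x e)
  joins-inc₁ {a , b} (inj₁ (refl , refl)) = Equivalence.from (T-∨ {a == a}) (inj₁ (==-refl a))
  joins-inc₁ {a , b} (inj₂ (refl , refl)) = Equivalence.from (T-∨ {a == b}) (inj₂ (==-refl b))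

  joins-inc₂ : ∀ {e : Fin n × Fin n} {x z} → Joins e x z → T (inc z e)
  joins-inc₂ {a , b} (inj₁ (refl , refl)) = Equivalence.from (T-∨ {a == b}) (inj₂ (==-refl b))
  joins-inc₂ {a , b} (inj₂ (refl , refl)) = Equivalence.from (T-∨ {a == a}) (inj₁ (==-refl a))

  joins-twice : ∀ {e : Fin n × Fin n} {x z z'} → Joins e x z → Joins e z z' → x ≢ z → x ≢ z' → ⊥
  joins-twice (inj₁ (refl , refl)) (inj₁ (x≡z , _))  x≢z _    = x≢z x≡z
  joins-twice (inj₁ (refl , refl)) (inj₂ (x≡z' , _)) _   x≢z' = x≢z' x≡z'
  joins-twice (inj₂ (refl , refl)) (inj₁ (_ , x≡z')) _   x≢z' = x≢z' x≡z'
  joins-twice (inj₂ (refl , refl)) (inj₂ (_ , x≡z))  x≢z _    = x≢z x≡z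

  module WalkFacts (E : Multigraph n) where

    EdgeAt : Fin n → List (Fin (length E)) → Set
    EdgeAt x es = Σ (Fin (length E)) λ i → i ∈ es × T (inc x (lookup E i))

    walk-start : ∀ {x y es vs} → Walk E x y es vs → x ≢ y → EdgeAt x es
    walk-start nil         x≢x = ⊥-elim (x≢x refl)
    walk-start (cons i j _) _  = i , here refl , joins-inc₁ j

    walk-end : ∀ {x y es vs} → Walk E x y es vs → x ≢ y → EdgeAt y es
    walk-end nil x≢x = ⊥-elim (x≢x refl)
    walk-end {y = y} (cons {z = z} i j w) _ with z Fin.≟ y
    ... | yes refl = i , here refl , joins-inc₂ j
    ... | no z≢y   = let (i′ , i′∈ , at) = walk-end w z≢y in i′ , there i′∈ , at

    vertices-end : ∀ {x y es vs} → Walk E x y es vs → y ∈ vs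
    vertices-end nil          = here refl
    vertices-end (cons _ _ w) = there (vertices-end w)

    vertices-start : ∀ {x y es vs} → Walk E x y es vs → x ∈ vs
    vertices-start nil          = here refl
    vertices-start (cons _ _ _) = here refl

    NonAdjacent : Fin n → Fin n → Set
    NonAdjacent x y = ∀ i → ¬ Joins (lookup E i) x y

    record TwoEdgesAt (v : Fin n) (es : List (Fin (length E))) : Set where
      field
        i₁ i₂ : Fin (length E)
        i₁∈   : i₁ ∈ es
        i₂∈   : i₂ ∈ es
        i₁≢i₂ : i₁ ≢ i₂
        at₁   : T (inc v (lookup E i₁))
        at₂   : T (inc v (lookup E i₂))

    record Interior (x y : Fin n) (es : List (Fin (length E))) : Set where
      field
        z        : Fin n
        z≢x      : z ≢ x
        z≢y      : z ≢ y
        twoEdges : TwoEdgesAt z es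

    interior-sym : ∀ {x y es} → Interior x y es → Interior y x es
    interior-sym I = record { z = z ; z≢x = z≢y ; z≢y = z≢x ; twoEdges = twoEdges }
      where open Interior I

    -- a path between distinct non-adjacent vertices has an interior vertex:
    -- its second vertex, entered and left by two different edges
    path-interior : ∀ {x y es vs} → Walk E x y es vs → Unique vs → x ≢ y → NonAdjacent x y → Interior x y es
    path-interior nil                    _ x≢x _      = ⊥-elim (x≢x refl)
    path-interior (cons i j nil)         _ _   nonAdj = ⊥-elim (nonAdj i j)
    path-interior (cons {z = z} i₁ j₁ (cons {z = z′} i₂ j₂ w)) ((x≢z ∷ x∉) ∷ (z∉ ∷ _)) _ _ = record
      { z = z ; z≢x = λ z≡x → x≢z (sym z≡x) ; z≢y = All.lookup z∉ (vertices-end w)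
      ; twoEdges = record
        { i₁ = i₁ ; i₂ = i₂ ; i₁∈ = here refl ; i₂∈ = there (here refl)
        ; i₁≢i₂ = λ { refl → joins-twice j₁ j₂ x≢z (All.lookup x∉ (vertices-start w)) }
        ; at₁ = joins-inc₂ j₁ ; at₂ = joins-inc₁ j₂ } }

    nonAdjacent-sym : ∀ {x y} → NonAdjacent x y → NonAdjacent y x
    nonAdjacent-sym nonAdj i = nonAdj i ∘ swap

-- An injection Fin (suc k) → Fin (suc (suc k)) missing w hits every other element:
-- otherwise removing w and the missed element would inject Fin (suc k) into Fin k.
injection-misses-one : ∀ {k} (f : Fin (suc k) → Fin (suc (suc k))) → (∀ {x y} → f x ≡ f y → x ≡ y) →
                       ∀ w → (∀ c → f c ≢ w) → ∀ u → u ≢ w → ∃ λ c → f c ≡ u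
injection-misses-one {k} f f-inj w misses u u≢w with Fin.any? (λ c → f c Fin.≟ u)
... | yes hit = hit
... | no ¬hit = ⊥-elim (ℕ.<-irrefl refl (Fin.injective⇒≤ g-inj))
  where
  w≢f : ∀ c → w ≢ f c
  w≢f c = misses c ∘ sym
  w≢u : w ≢ u
  w≢u = u≢w ∘ sym
  -- f with w removed from the codomain, then with u removed as well
  f′ : Fin (suc k) → Fin (suc k)
  f′ c = punchOut (w≢f c)
  u′ : Fin (suc k)
  u′ = punchOut w≢u
  u′≢f′ : ∀ c → u′ ≢ f′ c
  u′≢f′ c eq = ¬hit (c , sym (Fin.punchOut-injective w≢u (w≢f c) eq))
  g : Fin (suc k) → Fin k
  g c = punchOut (u′≢f′ c)
  g-inj : ∀ {x y} → g x ≡ g y → x ≡ y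
  g-inj eq = f-inj (Fin.punchOut-injective (w≢f _) (w≢f _) (Fin.punchOut-injective (u′≢f′ _) (u′≢f′ _) eq))

-- a pair {a, b} of distinct vertices, listed in increasing order as the immersion stores its route
record OPair {m} (a b : Fin m) : Set where
  field
    lo hi : Fin m
    lo<hi : lo <ᶠ hi
    ends  : (lo ≡ a × hi ≡ b) ⊎ (lo ≡ b × hi ≡ a)

orient : ∀ {m} {a b : Fin m} → a ≢ b → OPair a b
orient {a = a} {b} a≢b with Fin.<-cmp a b
... | tri< a<b _ _ = record { lo = a ; hi = b ; lo<hi = a<b ; ends = inj₁ (refl , refl) }
... | tri≈ _ a≡b _ = ⊥-elim (a≢b a≡b)
... | tri> _ _ b<a = record { lo = b ; hi = a ; lo<hi = b<a ; ends = inj₂ (refl , refl) }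

SameSet : ∀ {m} → Fin m → Fin m → Fin m → Fin m → Set
SameSet a b a′ b′ = (a ≡ a′ × b ≡ b′) ⊎ (a ≡ b′ × b ≡ a′)

sameOrder⇒SameSet : ∀ {m} {a b a′ b′ : Fin m} (o : OPair a b) (o′ : OPair a′ b′) →
                    OPair.lo o ≡ OPair.lo o′ → OPair.hi o ≡ OPair.hi o′ → SameSet a b a′ b′
sameOrder⇒SameSet o o′ refl refl with OPair.ends o | OPair.ends o′
... | inj₁ (refl , refl) | inj₁ (refl , refl) = inj₁ (refl , refl)
... | inj₁ (refl , refl) | inj₂ (refl , refl) = inj₂ (refl , refl)
... | inj₂ (refl , refl) | inj₁ (refl , refl) = inj₂ (refl , refl)
... | inj₂ (refl , refl) | inj₂ (refl , refl) = inj₁ (refl , refl)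

module ImmersionFacts {k n} {E : Multigraph n} (imm : Immersion (K (suc k)) E) where

  open Immersion imm
  open WalkFacts E

  adj-K : ∀ {a b : Fin (suc k)} → a <ᶠ b → T (adj (K (suc k)) a b)
  adj-K {a} {b} a<b = ¬T⇒T-not (λ a=b → ℕ.<-irrefl (ℕ.≡ᵇ⇒≡ (toℕ a) (toℕ b) a=b) a<b)

  module _ {a b : Fin (suc k)} (o : OPair a b) where
    open OPair o

    route′ : List (Fin (length E))
    route′ = route lo hi lo<hi (adj-K lo<hi)

    walk′ : Walk E (φ lo) (φ hi) route′ (verts lo hi lo<hi (adj-K lo<hi))
    walk′ = isWalk lo hi lo<hi (adj-K lo<hi)

    path′ : Unique (verts lo hi lo<hi (adj-K lo<hi))
    path′ = isPath lo hi lo<hi (adj-K lo<hi)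

    φlo≢φhi : φ lo ≢ φ hi
    φlo≢φhi φlo≡φhi = ℕ.<-irrefl (cong toℕ (φ-inj φlo≡φhi)) lo<hi

  routes-disjoint : ∀ {a b a′ b′} (o : OPair a b) (o′ : OPair a′ b′) → ¬ SameSet a b a′ b′ →
                    ∀ {i} → i ∈ route′ o → i ∈ route′ o′ → ⊥
  routes-disjoint o o′ different i∈ i∈′ =
    disjoint (OPair.lo o) (OPair.hi o) (OPair.lo o′) (OPair.hi o′)
             (OPair.lo<hi o) (adj-K (OPair.lo<hi o)) (OPair.lo<hi o′) (adj-K (OPair.lo<hi o′))
             (λ (lo≡ , hi≡) → different (sameOrder⇒SameSet o o′ lo≡ hi≡)) _ i∈ i∈′

  route-leaves : ∀ {a b} (o : OPair a b) → EdgeAt (φ a) (route′ o)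
  route-leaves o with OPair.ends o
  ... | inj₁ (refl , _) = walk-start (walk′ o) (φlo≢φhi o)
  ... | inj₂ (_ , refl) = walk-end (walk′ o) (φlo≢φhi o)

  toOther : ∀ c (e : Fin k) → OPair c (punchIn c e)
  toOther c e = orient (λ c≡ → Fin.punchInᵢ≢i c e (sym c≡))

  -- The k routes at c each have their own edge at φ c; edges at φ c avoiding
  -- these routes come on top of them.
  branch-load : ∀ c {X} → Unique X → (∀ {i} → i ∈ X → T (inc (φ c) (lookup E i))) →
                (∀ {i} → i ∈ X → ∀ e → i ∉ route′ (toOther c e)) → k + length X ≤ degE (φ c) E
  branch-load c {X} distinctX atX offX = subst (_≤ degE (φ c) E) len (edgesAt-≤ E (φ c) distinct incident)
    where
    out : Fin k → Fin (length E)
    out e = proj₁ (route-leaves (toOther c e))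
    out∈ : ∀ e → out e ∈ route′ (toOther c e)
    out∈ e = proj₁ (proj₂ (route-leaves (toOther c e)))
    out-inj : ∀ {e e′} → out e ≡ out e′ → e ≡ e′
    out-inj {e} {e′} eq with e Fin.≟ e′
    ... | yes e≡e′ = e≡e′
    ... | no  e≢e′ = ⊥-elim (routes-disjoint (toOther c e) (toOther c e′) different (out∈ e) (subst (_∈ _) (sym eq) (out∈ e′)))
      where
      different : ¬ SameSet c (punchIn c e) c (punchIn c e′)
      different (inj₁ (_ , same)) = e≢e′ (Fin.punchIn-injective c e e′ same)
      different (inj₂ (c≡ , _))   = Fin.punchInᵢ≢i c e′ (sym c≡)
    outs : List (Fin (length E))
    outs = map out (allFin k)
    distinct : Unique (outs ++ X)
    distinct = Unique.++⁺ (Unique.map⁺ out-inj (Unique.allFin⁺ k)) distinctX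
      λ { {i} (i∈outs , i∈X) → let (e , _ , i≡) = ∈-map⁻ out i∈outs in
                                offX i∈X e (subst (_∈ route′ (toOther c e)) (sym i≡) (out∈ e)) }
    incident : ∀ {i} → i ∈ outs ++ X → T (inc (φ c) (lookup E i))
    incident i∈ with ∈-++⁻ outs i∈
    ... | inj₁ i∈outs = let (e , _ , i≡) = ∈-map⁻ out i∈outs in
                        subst (λ i → T (inc (φ c) (lookup E i))) (sym i≡) (proj₂ (proj₂ (route-leaves (toOther c e))))
    ... | inj₂ i∈X    = atX i∈X
    len : length (outs ++ X) ≡ k + length X
    len = trans (List.length-++ outs) (cong (_+ length X) (trans (List.length-map out (allFin k)) (List.length-tabulate _)))

  branch-degree : ∀ c → k ≤ degE (φ c) E
  branch-degree c = subst (_≤ degE (φ c) E) (ℕ.+-identityʳ k) (branch-load c [] (λ ()) (λ ()))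

  route-interior : ∀ {c₁ c₂} (o : OPair c₁ c₂) → NonAdjacent (φ c₁) (φ c₂) → Interior (φ c₁) (φ c₂) (route′ o)
  route-interior o nonAdj with OPair.ends o
  ... | inj₁ (refl , refl) = path-interior (walk′ o) (path′ o) (φlo≢φhi o) nonAdj
  ... | inj₂ (refl , refl) = interior-sym (path-interior (walk′ o) (path′ o) (φlo≢φhi o) (nonAdjacent-sym nonAdj))

  -- If no vertex has degree above k + 1, then no branch vertex is interior to a
  -- route: it would carry its k own route edges plus two more.
  interior-not-branch : (∀ v → degE v E ≤ suc k) → ∀ {c₁ c₂} (o : OPair c₁ c₂) →
                        (I : Interior (φ c₁) (φ c₂) (route′ o)) → ∀ c → φ c ≢ Interior.z I
  interior-not-branch maxDeg {c₁} {c₂} o I c φc≡z = ℕ.<-irrefl refl (ℕ.≤-trans overloaded (maxDeg (φ c)))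
    where
    open Interior I
    open TwoEdgesAt twoEdges
    atφc : ∀ {i} → T (inc z (lookup E i)) → T (inc (φ c) (lookup E i))
    atφc {i} = subst (λ x → T (inc x (lookup E i))) (sym φc≡z)
    offRoutes : ∀ {i} → i ∈ route′ o → ∀ e → i ∉ route′ (toOther c e)
    offRoutes i∈ e = routes-disjoint o (toOther c e) different i∈
      where
      different : ¬ SameSet c₁ c₂ c (punchIn c e)
      different (inj₁ (c₁≡c , _)) = z≢x (trans (sym φc≡z) (cong φ (sym c₁≡c)))
      different (inj₂ (_ , c₂≡c)) = z≢y (trans (sym φc≡z) (cong φ (sym c₂≡c)))
    overloaded : suc (suc k) ≤ degE (φ c) E
    overloaded = subst (_≤ degE (φ c) E) (ℕ.+-comm k 2)
      (branch-load c ((i₁≢i₂ ∷ []) ∷ [] ∷ [])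
        (λ { (here refl) → atφc at₁ ; (there (here refl)) → atφc at₂ })
        (λ { (here refl) → offRoutes i₁∈ ; (there (here refl)) → offRoutes i₂∈ }))

  record Visit (v : Fin n) : Set where
    field
      {a b} : Fin (suc k)
      pair  : OPair a b
      edges : TwoEdgesAt v (route′ pair)

  Different : ∀ {v} → Visit v → Visit v → Set
  Different s t = ¬ SameSet (Visit.a s) (Visit.b s) (Visit.a t) (Visit.b t)

  visits-≤ : ∀ {v} (ss : List (Visit v)) → AllPairs Different ss → length ss * 2 ≤ degE v E
  visits-≤ {v} ss different = subst (_≤ degE v E) (len ss) (edgesAt-≤ E v (distinct different) (incident ss))
    where
    open Visit
    open TwoEdgesAt
    edgesOf : List (Visit v) → List (Fin (length E))
    edgesOf []       = []
    edgesOf (s ∷ ss) = i₁ (edges s) ∷ i₂ (edges s) ∷ edgesOf ss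
    avoids : ∀ s {i ss} → i ∈ route′ (pair s) → All (Different s) ss → All (i ≢_) (edgesOf ss)
    avoids s i∈ []                   = []
    avoids s i∈ (_∷_ {t} s≠t s≠ts) =
      (λ { refl → routes-disjoint (pair s) (pair t) s≠t i∈ (i₁∈ (edges t)) }) ∷
      (λ { refl → routes-disjoint (pair s) (pair t) s≠t i∈ (i₂∈ (edges t)) }) ∷ avoids s i∈ s≠ts
    distinct : ∀ {ss} → AllPairs Different ss → Unique (edgesOf ss)
    distinct []                         = []
    distinct (_∷_ {s} s≠ss different) =
      (i₁≢i₂ (edges s) ∷ avoids s (i₁∈ (edges s)) s≠ss) ∷ avoids s (i₂∈ (edges s)) s≠ss ∷ distinct different
    incident : ∀ ss {i} → i ∈ edgesOf ss → T (inc v (lookup E i))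
    incident (s ∷ _)  (here refl)         = at₁ (edges s)
    incident (s ∷ _)  (there (here refl)) = at₂ (edges s)
    incident (_ ∷ ss) (there (there i∈))  = incident ss i∈
    len : ∀ ss → length (edgesOf ss) ≡ length ss * 2
    len []       = refl
    len (_ ∷ ss) = cong (suc ∘ suc) (len ss)

adjN : ℕ → ℕ → Bool
adjN a b = not (a ≡ᵇ b) ∧ not (removed a b)

allFin-toℕ : ∀ n → map toℕ (allFin n) ≡ upTo n
allFin-toℕ zero    = refl
allFin-toℕ (suc n) = cong (0 ∷_) (begin
  map toℕ (tabulate fsuc)            ≡⟨ List.map-tabulate fsuc toℕ ⟩
  tabulate (suc ∘ toℕ)               ≡⟨ List.map-tabulate toℕ suc ⟨
  map suc (tabulate toℕ)             ≡⟨ cong (map suc) (List.map-tabulate (λ i → i) toℕ) ⟨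
  map suc (map toℕ (allFin n))       ≡⟨ cong (map suc) (allFin-toℕ n) ⟩
  map suc (upTo n)                   ≡⟨ List.map-upTo suc n ⟩
  applyUpTo suc n                    ∎)
  where open ≡-Reasoning

count-toℕ : ∀ n (p : ℕ → Bool) → count (p ∘ toℕ) (allFin n) ≡ count p (upTo n)
count-toℕ n p = trans (sym (sumOver-map (ind ∘ p) toℕ (allFin n))) (cong (count p) (allFin-toℕ n))

degN : ℕ → ℕ → ℕ
degN d v = count (adjN v) (upTo (suc d))

deg-P : ∀ d (v : Fin (suc d)) → deg (P d) v ≡ degN d (toℕ v)
deg-P d v = count-toℕ (suc d) (adjN (toℕ v))

data Mid : ℕ → Set where
  mid1 : Mid 1
  mid4 : Mid 4
  mid7 : Mid 7

-- v together with the vertices whose edge to v was deleted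
coNbrs : ℕ → List ℕ
coNbrs 0 = 0 ∷ 1 ∷ []
coNbrs 1 = 0 ∷ 1 ∷ 2 ∷ []
coNbrs 2 = 1 ∷ 2 ∷ []
coNbrs 3 = 3 ∷ 4 ∷ []
coNbrs 4 = 3 ∷ 4 ∷ 5 ∷ []
coNbrs 5 = 4 ∷ 5 ∷ []
coNbrs 6 = 6 ∷ 7 ∷ []
coNbrs 7 = 6 ∷ 7 ∷ 8 ∷ []
coNbrs 8 = 7 ∷ 8 ∷ []
coNbrs (suc (suc (suc (suc (suc (suc (suc (suc (suc k))))))))) = 9 + k / 2 * 2 ∷ 10 + k / 2 * 2 ∷ []

smallTable : All (λ v → All (λ u → T (adjN v u) ⊎ u ∈ coNbrs v) (upTo 9)) (upTo 9)
smallTable = from-yes (all? (λ v → all? (λ u → T? (adjN v u) ⊎-dec (u ∈? coNbrs v)) (upTo 9)) (upTo 9))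

data Region : ℕ → Set where
  small : ∀ {v} → v < 9 → Region v
  large : ∀ k → Region (9 + k)

region : ∀ v → Region v
region v with v ℕ.<? 9
... | yes v<9 = small v<9
... | no  v≮9 = subst Region (ℕ.m+[n∸m]≡n (ℕ.≮⇒≥ v≮9)) (large (v ∸ 9))

adjN-sym : ∀ a b → adjN a b ≡ adjN b a
adjN-sym a b = cong₂ (λ x y → not x ∧ not y) (≡ᵇ-sym a b) (∨-comm (removedR a b) (removedR b a))

farSmall : ∀ {v} j → v < 9 → T (adjN v (9 + j))
farSmall {0} j _ = _
farSmall {1} j _ = _
farSmall {2} j _ = _
farSmall {3} j _ = _
farSmall {4} j _ = _
farSmall {5} j _ = _
farSmall {6} j _ = _
farSmall {7} j _ = _
farSmall {8} j _ = _
farSmall {suc (suc (suc (suc (suc (suc (suc (suc (suc _))))))))} j (s≤s (s≤s (s≤s (s≤s (s≤s (s≤s (s≤s (s≤s (s≤s ())))))))))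

-- two vertices 9 + k, 9 + j are non-adjacent only inside a matched pair;
-- the hypothesis is the unfolding of ¬ adjN (9 + k) (9 + j)
sameHalf : ∀ k j → T (not (not (k ≡ᵇ j) ∧ not ((k / 2 ≡ᵇ j / 2) ∨ (j / 2 ≡ᵇ k / 2)))) → j / 2 ≡ k / 2
sameHalf k j na with k ≡ᵇ j in k=j | k / 2 ≡ᵇ j / 2 in h₁ | j / 2 ≡ᵇ k / 2 in h₂
... | true  | _     | _    = cong (_/ 2) (sym (ℕ.≡ᵇ⇒≡ k j (subst T (sym k=j) _)))
... | false | true  | _    = sym (ℕ.≡ᵇ⇒≡ (k / 2) (j / 2) (subst T (sym h₁) _))
... | false | false | true = ℕ.≡ᵇ⇒≡ (j / 2) (k / 2) (subst T (sym h₂) _)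

halves : ∀ j q → j / 2 ≡ q → j ≡ q * 2 ⊎ j ≡ 1 + q * 2
halves j q j/2≡q = byRemainder (j % 2) (ℕ.m%n<n j 2)
  (trans (ℕ.m≡m%n+[m/n]*n j 2) (cong (λ x → j % 2 + x * 2) j/2≡q))
  where
  byRemainder : ∀ r → r < 2 → j ≡ r + q * 2 → j ≡ q * 2 ⊎ j ≡ 1 + q * 2
  byRemainder 0 _ eq = inj₁ eq
  byRemainder 1 _ eq = inj₂ eq
  byRemainder (suc (suc _)) (s≤s (s≤s ())) _

coNbrs-complete : ∀ v u → T (not (adjN v u)) → u ∈ coNbrs v
coNbrs-complete v u na with region v | region u
... | small v<9 | small u<9 with All.lookup (All.lookup smallTable (∈-upTo⁺ v<9)) (∈-upTo⁺ u<9)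
...   | inj₁ adj = ⊥-elim (T-not⇒¬T na adj)
...   | inj₂ u∈  = u∈
coNbrs-complete v u na | small v<9 | large j = ⊥-elim (T-not⇒¬T na (farSmall j v<9))
coNbrs-complete v u na | large k | small u<9 =
  ⊥-elim (T-not⇒¬T na (subst T (adjN-sym u (9 + k)) (farSmall k u<9)))
coNbrs-complete v u na | large k | large j with halves j (k / 2) (sameHalf k j na)
... | inj₁ j≡ = here (cong (9 +_) j≡)
... | inj₂ j≡ = there (here (cong (9 +_) j≡))

mid? : ∀ v → Dec (Mid v)
mid? v with v ℕ.≟ 1 | v ℕ.≟ 4 | v ℕ.≟ 7
... | yes refl | _        | _        = yes mid1
... | no _     | yes refl | _        = yes mid4
... | no _     | no _     | yes refl = yes mid7
... | no v≢1   | no v≢4   | no v≢7   = no λ { mid1 → v≢1 refl ; mid4 → v≢4 refl ; mid7 → v≢7 refl }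

coNbrs-short : ∀ v → ¬ Mid v → length (coNbrs v) ≤ 2
coNbrs-short v ¬mid with region v
... | large k   = ℕ.≤-refl
... | small v<9 with All.lookup shortTable (∈-upTo⁺ v<9)
  where
  shortTable : All (λ v → Mid v ⊎ length (coNbrs v) ≤ 2) (upTo 9)
  shortTable = from-yes (all? (λ v → mid? v ⊎-dec (length (coNbrs v) ℕ.≤? 2)) (upTo 9))
...   | inj₁ mid   = ⊥-elim (¬mid mid)
...   | inj₂ short = short

coNbrs-length : ∀ v → length (coNbrs v) ≤ 3
coNbrs-length v with mid? v
... | yes mid1 = ℕ.≤-refl
... | yes mid4 = ℕ.≤-refl
... | yes mid7 = ℕ.≤-refl
... | no ¬mid  = ℕ.m≤n⇒m≤1+n (coNbrs-short v ¬mid)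

ExactCoNbrs : ℕ → Set
ExactCoNbrs v = Unique (coNbrs v) × All (λ u → u < 9 × T (not (adjN v u))) (coNbrs v)

exactCoNbrs? : ∀ v → Dec (ExactCoNbrs v)
exactCoNbrs? v = unique? (coNbrs v) ×-dec all? (λ u → u ℕ.<? 9 ×-dec T? (not (adjN v u))) (coNbrs v)

coNbrs-mid : ∀ {v} → Mid v → ExactCoNbrs v
coNbrs-mid mid1 = from-yes (exactCoNbrs? 1)
coNbrs-mid mid4 = from-yes (exactCoNbrs? 4)
coNbrs-mid mid7 = from-yes (exactCoNbrs? 7)

coNbrs-mid-length : ∀ {v} → Mid v → length (coNbrs v) ≡ 3
coNbrs-mid-length mid1 = refl
coNbrs-mid-length mid4 = refl
coNbrs-mid-length mid7 = refl

open DecCounting ℕ._≟_ using (unique⇒≤count; count≤cover)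

degN-complement : ∀ d v → degN d v + count (not ∘ adjN v) (upTo (suc d)) ≡ suc d
degN-complement d v = trans (count-complement (adjN v) (upTo (suc d))) (List.length-upTo (suc d))

-- lower bound: v misses at most the vertices in coNbrs v
degN-≥ : ∀ d v → suc d ≤ degN d v + length (coNbrs v)
degN-≥ d v = begin
  suc d                                          ≡⟨ degN-complement d v ⟨
  degN d v + count (not ∘ adjN v) (upTo (suc d)) ≤⟨ ℕ.+-monoʳ-≤ (degN d v) missed ⟩
  degN d v + length (coNbrs v)                   ∎
  where
  open ℕ.≤-Reasoning
  missed : count (not ∘ adjN v) (upTo (suc d)) ≤ length (coNbrs v)
  missed = count≤cover (not ∘ adjN v) (Unique.upTo⁺ (suc d)) (coNbrs v) (λ _ → coNbrs-complete v _)

degN-≤ : ∀ d v {ws} → Unique ws → All (λ u → u < suc d × T (not (adjN v u))) ws →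
         degN d v + length ws ≤ suc d
degN-≤ d v {ws} distinct nonAdj = begin
  degN d v + length ws                           ≤⟨ ℕ.+-monoʳ-≤ (degN d v) missed ⟩
  degN d v + count (not ∘ adjN v) (upTo (suc d)) ≡⟨ degN-complement d v ⟩
  suc d                                          ∎
  where
  open ℕ.≤-Reasoning
  missed : length ws ≤ count (not ∘ adjN v) (upTo (suc d))
  missed = unique⇒≤count (not ∘ adjN v) (upTo (suc d)) distinct λ u∈ →
    let (u<1+d , na) = All.lookup nonAdj u∈ in ∈-upTo⁺ u<1+d , na

∸-≤ : ∀ {m n} k → m ≤ n + k → m ∸ k ≤ n
∸-≤ {m} {n} k le = ℕ.m≤n+o⇒m∸n≤o m k (ℕ.≤-trans le (ℕ.≤-reflexive (ℕ.+-comm n k)))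

degN-min : ∀ d v → d ∸ 2 ≤ degN d v
degN-min d v = ∸-≤ 3 (ℕ.≤-trans (degN-≥ d v) (ℕ.+-monoʳ-≤ (degN d v) (coNbrs-length v)))

degN-nonMid : ∀ d v → ¬ Mid v → d ∸ 1 ≤ degN d v
degN-nonMid d v ¬mid = ∸-≤ 2 (ℕ.≤-trans (degN-≥ d v) (ℕ.+-monoʳ-≤ (degN d v) (coNbrs-short v ¬mid)))

degN-max : ∀ d v → v < suc d → degN d v ≤ d
degN-max d v v<1+d = ℕ.+-cancelʳ-≤ 1 (degN d v) d (subst (degN d v + 1 ≤_) (ℕ.+-comm 1 d)
  (degN-≤ d v {v ∷ []} ([] ∷ []) ((v<1+d , subst (T ∘ not) (sym (loopless v)) _) ∷ [])))
  where
  loopless : ∀ v → adjN v v ≡ false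
  loopless v rewrite ≡ᵇ-refl v = refl

degN-mid : ∀ d → 8 ≤ d → ∀ {v} → Mid v → degN d v ≡ d ∸ 2
degN-mid d 8≤d {v} mid = ℕ.≤-antisym upper (degN-min d v)
  where
  inRange : ∀ {u} → u < 9 → u < suc d
  inRange u<9 = ℕ.<-≤-trans u<9 (s≤s 8≤d)
  upper : degN d v ≤ d ∸ 2
  upper = ℕ.m+n≤o⇒m≤o∸n (degN d v)
    (subst (λ k → degN d v + k ≤ suc d) (coNbrs-mid-length mid)
      (degN-≤ d v (proj₁ (coNbrs-mid mid))
        (All.map (λ (u<9 , na) → inRange u<9 , na) (proj₂ (coNbrs-mid mid)))))

mids : List ℕ
mids = 1 ∷ 4 ∷ 7 ∷ []

Mid⇒∈mids : ∀ {v} → Mid v → v ∈ mids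
Mid⇒∈mids mid1 = here refl
Mid⇒∈mids mid4 = there (here refl)
Mid⇒∈mids mid7 = there (there (here refl))

∈mids⇒Mid : ∀ {v} → v ∈ mids → Mid v
∈mids⇒Mid (here refl)                 = mid1
∈mids⇒Mid (there (here refl))         = mid4
∈mids⇒Mid (there (there (here refl))) = mid7

mid<9 : ∀ {v} → Mid v → v < 9
mid<9 mid1 = from-yes (1 ℕ.<? 9)
mid<9 mid4 = from-yes (4 ℕ.<? 9)
mid<9 mid7 = from-yes (7 ℕ.<? 9)

module PodDegrees (d : ℕ) (8≤d : 8 ≤ d) where

  below9 : ∀ {u} → u < 9 → u < suc d
  below9 u<9 = ℕ.<-≤-trans u<9 (s≤s 8≤d)

  lowDeg : ℕ → Bool
  lowDeg v = degN d v ≡ᵇ d ∸ 2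

  lowDeg⇒Mid : ∀ v → T (lowDeg v) → Mid v
  lowDeg⇒Mid v low with mid? v
  ... | yes mid = mid
  ... | no ¬mid = ⊥-elim (ℕ.<-irrefl (sym (ℕ.≡ᵇ⇒≡ (degN d v) (d ∸ 2) low)) (ℕ.<-≤-trans d∸2<d∸1 (degN-nonMid d v ¬mid)))
    where
    d∸2<d∸1 : d ∸ 2 < d ∸ 1
    d∸2<d∸1 = ℕ.∸-monoʳ-< (ℕ.n<1+n 1) (ℕ.≤-trans (ℕ.m≤m+n 2 6) 8≤d)

  Mid⇒lowDeg : ∀ {v} → Mid v → T (lowDeg v)
  Mid⇒lowDeg mid = ℕ.≡⇒≡ᵇ _ _ (degN-mid d 8≤d mid)

  countA-P : countA d (P d) ≡ 3
  countA-P = begin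
    countA d (P d)                  ≡⟨ sumOver-cong (λ v → cong (λ k → ind (k ≡ᵇ d ∸ 2)) (deg-P d v)) (allFin (suc d)) ⟩
    count (lowDeg ∘ toℕ) (allFin (suc d)) ≡⟨ count-toℕ (suc d) lowDeg ⟩
    count lowDeg (upTo (suc d))     ≡⟨ ℕ.≤-antisym atMost atLeast ⟩
    3                               ∎
    where
    open ≡-Reasoning
    atMost : count lowDeg (upTo (suc d)) ≤ 3
    atMost = count≤cover lowDeg (Unique.upTo⁺ (suc d)) mids (λ {v} _ low → Mid⇒∈mids (lowDeg⇒Mid v low))
    atLeast : 3 ≤ count lowDeg (upTo (suc d))
    atLeast = unique⇒≤count lowDeg (upTo (suc d)) (from-yes (unique? mids)) λ v∈ →
      let mid = ∈mids⇒Mid v∈ in ∈-upTo⁺ (below9 (mid<9 mid)) , Mid⇒lowDeg mid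

  minDeg-P : ∀ v → d ∸ 2 ≤ deg (P d) v
  minDeg-P v = subst (d ∸ 2 ≤_) (sym (deg-P d v)) (degN-min d (toℕ v))

  fewA-P : countA d (P d) ≤ d ∸ 2
  fewA-P = subst (_≤ d ∸ 2) (sym countA-P) (ℕ.m+n≤o⇒m≤o∸n 3 (ℕ.≤-trans (ℕ.m≤m+n 5 3) 8≤d))

  inA⇒Mid : ∀ v → InA d (P d) v → Mid (toℕ v)
  inA⇒Mid v inA = lowDeg⇒Mid (toℕ v) (ℕ.≡⇒≡ᵇ _ _ (trans (sym (deg-P d v)) inA))

-- a non-edge {u₁, u₂} of P_d avoiding w and not joining two middle vertices:
-- such a pair cannot be joined directly once one edge between middle vertices is added
Forced : ℕ → ℕ → ℕ × ℕ → Set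
Forced d w (u₁ , u₂) =
  u₁ < suc d × u₂ < suc d × T (not (adjN u₁ u₂)) × ¬ (Mid u₁ × Mid u₂) × u₁ ≢ w × u₂ ≢ w × u₁ ≢ u₂

forced? : ∀ d w pr → Dec (Forced d w pr)
forced? d w (u₁ , u₂) =
  u₁ ℕ.<? suc d ×-dec u₂ ℕ.<? suc d ×-dec T? (not (adjN u₁ u₂)) ×-dec ¬? (mid? u₁ ×-dec mid? u₂) ×-dec
  ¬? (u₁ ℕ.≟ w) ×-dec ¬? (u₂ ℕ.≟ w) ×-dec ¬? (u₁ ℕ.≟ u₂)

forced-mono : ∀ {d d′ w pr} → d ≤ d′ → Forced d w pr → Forced d′ w pr
forced-mono d≤d′ (lt₁ , lt₂ , rest) = ℕ.<-≤-trans lt₁ (s≤s d≤d′) , ℕ.<-≤-trans lt₂ (s≤s d≤d′) , rest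

-- the four non-edges on the two deleted paths not containing the middle vertex w
otherPaths : ℕ → List (ℕ × ℕ)
otherPaths 1 = (3 , 4) ∷ (4 , 5) ∷ (6 , 7) ∷ (7 , 8) ∷ []
otherPaths 4 = (0 , 1) ∷ (1 , 2) ∷ (6 , 7) ∷ (7 , 8) ∷ []
otherPaths 7 = (0 , 1) ∷ (1 , 2) ∷ (3 , 4) ∷ (4 , 5) ∷ []
otherPaths _ = []

matched : ℕ → List (ℕ × ℕ)
matched = applyUpTo λ j → 9 + j * 2 , 10 + j * 2

-- pairs are told apart by the sums of their labels
key : ℕ × ℕ → ℕ
key (u₁ , u₂) = u₁ + u₂

OtherPaths : ℕ → Set
OtherPaths w = All (Forced 8 w) (otherPaths w) × All (_< 19) (map key (otherPaths w)) ×
               Unique (map key (otherPaths w)) × length (otherPaths w) ≡ 4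

otherPaths? : ∀ w → Dec (OtherPaths w)
otherPaths? w = all? (forced? 8 w) (otherPaths w) ×-dec all? (ℕ._<? 19) (map key (otherPaths w)) ×-dec
                unique? (map key (otherPaths w)) ×-dec length (otherPaths w) ℕ.≟ 4

otherPaths-facts : ∀ {w} → Mid w → OtherPaths w
otherPaths-facts mid1 = from-yes (otherPaths? 1)
otherPaths-facts mid4 = from-yes (otherPaths? 4)
otherPaths-facts mid7 = from-yes (otherPaths? 7)

removed⇒nonAdj : ∀ a b → removedR a b ≡ true → T (not (adjN a b))
removed⇒nonAdj a b r rewrite r | ∧-zeroʳ (not (a ≡ᵇ b)) = _

-- (stated as lemmas so that they can be used with rewrite)
half-of-even : ∀ j → j * 2 / 2 ≡ j
half-of-even j = ℕ.m*n/n≡m j 2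

half-of-odd : ∀ j → suc (j * 2) / 2 ≡ j
half-of-odd j = trans (ℕ.+-distrib-/-∣ʳ 1 {d = 2} (divides-refl j)) (ℕ.m*n/n≡m j 2)

matched-removed : ∀ j → removedR (9 + j * 2) (10 + j * 2) ≡ true
matched-removed j rewrite half-of-even j | half-of-odd j = ≡ᵇ-refl j

large≢mid : ∀ x {w} → Mid w → 9 + x ≢ w
large≢mid x mid1 ()
large≢mid x mid4 ()
large≢mid x mid7 ()

matched-forced : ∀ {d w} → Mid w → ∀ m → 8 + m * 2 ≤ d → All (Forced d w) (matched m)
matched-forced {d} {w} mid m 8+2m≤d = All.applyUpTo⁺₁ _ m forcedAt
  where
  forcedAt : ∀ {j} → j < m → Forced d w (9 + j * 2 , 10 + j * 2)
  forcedAt {j} j<m =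
    ℕ.m≤n⇒m≤1+n 10+2j≤d , s≤s 10+2j≤d , removed⇒nonAdj (9 + j * 2) (10 + j * 2) (matched-removed j) ,
    (λ (mid₁ , _) → large≢mid (j * 2) mid₁ refl) , large≢mid (j * 2) mid , large≢mid (suc (j * 2)) mid ,
    ℕ.1+n≢n ∘ sym
    where
    10+2j≤d : 10 + j * 2 ≤ d
    10+2j≤d = ℕ.≤-trans (ℕ.+-monoʳ-≤ 8 (ℕ.*-monoˡ-≤ 2 j<m)) 8+2m≤d

matched-key : ∀ j → (9 + j * 2) + (10 + j * 2) ≡ 19 + j * 4
matched-key = solve-∀

matched-keys : ∀ m → map key (matched m) ≡ applyUpTo (λ j → key (9 + j * 2 , 10 + j * 2)) m
matched-keys m = List.map-applyUpTo _ key m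

matched-keys-distinct : ∀ m → Unique (map key (matched m))
matched-keys-distinct m = subst Unique (sym (matched-keys m)) (Unique.applyUpTo⁺₁ _ m increasing)
  where
  increasing : ∀ {i j} → i < j → j < m → key (9 + i * 2 , 10 + i * 2) ≢ key (9 + j * 2 , 10 + j * 2)
  increasing {i} {j} i<j _ same = ℕ.<-irrefl (ℕ.*-cancelʳ-≡ i j 4 (ℕ.+-cancelˡ-≡ 19 _ _ sameKey)) i<j
    where
    sameKey : 19 + i * 4 ≡ 19 + j * 4
    sameKey = trans (sym (matched-key i)) (trans same (matched-key j))

matched-keys-large : ∀ m → All (19 ≤_) (map key (matched m))
matched-keys-large m = subst (All (19 ≤_)) (sym (matched-keys m))
  (All.applyUpTo⁺₁ _ m λ {j} _ → subst (19 ≤_) (sym (matched-key j)) (ℕ.m≤m+n 19 (j * 4)))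

forcedPairs : ℕ → ℕ → List (ℕ × ℕ)
forcedPairs w m = otherPaths w ++ matched m

module _ {w} (mid : Mid w) (m : ℕ) where

  private
    facts = otherPaths-facts mid

  forcedPairs-forced : ∀ {d} → 8 ≤ d → 8 + m * 2 ≤ d → All (Forced d w) (forcedPairs w m)
  forcedPairs-forced 8≤d 8+2m≤d =
    All.++⁺ (All.map (forced-mono 8≤d) (proj₁ facts)) (matched-forced mid m 8+2m≤d)

  forcedPairs-keys : Unique (map key (forcedPairs w m))
  forcedPairs-keys = subst Unique (sym (List.map-++ key (otherPaths w) (matched m)))
    (Unique.++⁺ (proj₁ (proj₂ (proj₂ facts))) (matched-keys-distinct m)
      λ (k∈ , k∈′) → ℕ.<⇒≱ (All.lookup (proj₁ (proj₂ facts)) k∈) (All.lookup (matched-keys-large m) k∈′))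

  forcedPairs-length : length (forcedPairs w m) ≡ 4 + m
  forcedPairs-length = trans (List.length-++ (otherPaths w))
    (cong₂ _+_ (proj₂ (proj₂ (proj₂ facts))) (List.length-applyUpTo _ m))

third : ∀ {a b} → Mid a → Mid b → a ≢ b → Σ ℕ λ w → Mid w × w ≢ a × w ≢ b
third mid1 mid1 a≢b = ⊥-elim (a≢b refl)
third mid1 mid4 _   = 7 , mid7 , (λ ()) , (λ ())
third mid1 mid7 _   = 4 , mid4 , (λ ()) , (λ ())
third mid4 mid1 _   = 7 , mid7 , (λ ()) , (λ ())
third mid4 mid4 a≢b = ⊥-elim (a≢b refl)
third mid4 mid7 _   = 1 , mid1 , (λ ()) , (λ ())
third mid7 mid1 _   = 4 , mid4 , (λ ()) , (λ ())
third mid7 mid4 _   = 1 , mid1 , (λ ()) , (λ ())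
third mid7 mid7 a≢b = ⊥-elim (a≢b refl)

halve : ∀ t → t / 2 * 2 ≤ t × t ≤ 1 + t / 2 * 2
halve t = subst (t / 2 * 2 ≤_) (sym t≡) (ℕ.m≤n+m _ (t % 2)) ,
          subst (_≤ 1 + t / 2 * 2) (sym t≡) (ℕ.+-monoˡ-≤ _ (ℕ.≤-pred (ℕ.m%n<n t 2)))
  where
  t≡ : t ≡ t % 2 + t / 2 * 2
  t≡ = ℕ.m≡m%n+[m/n]*n t 2

module NoImmersion (d₁ : ℕ) (8≤d : 8 ≤ suc d₁) {p q : Fin (suc (suc d₁))}
                   (mid-p : Mid (toℕ p)) (mid-q : Mid (toℕ q)) (p≢q : p ≢ q)
                   (imm : Immersion (K (suc d₁)) (addPairs (P (suc d₁)) ((p , q) ∷ []))) where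

  d : ℕ
  d = suc d₁

  G : SimpleGraph (suc d)
  G = P d

  E : Multigraph (suc d)
  E = addPairs G ((p , q) ∷ [])

  open Immersion imm using (φ; φ-inj)
  open WalkFacts E
  open ImmersionFacts imm
  open PodDegrees d 8≤d

  midDegree : ∀ {v} → Mid (toℕ v) → deg G v ≡ d ∸ 2
  midDegree {v} mid = trans (deg-P d v) (degN-mid d 8≤d mid)

  degE-E : ∀ v → degE v E ≡ degE v (edgeList G) + (ind (inc v (p , q)) + 0)
  degE-E v = degE-++ v (edgeList G) ((p , q) ∷ [])

  meets-mid : ∀ {v} → T (inc v (p , q)) → Mid (toℕ v)
  meets-mid {v} meets with inc-ends {v = v} {a = p} {b = q} meets
  ... | inj₁ refl = mid-p
  ... | inj₂ refl = mid-q

  maxDegE : ∀ v → degE v E ≤ d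
  maxDegE v rewrite degE-E v with inc v (p , q) in meets
  ... | false = ℕ.≤-trans (ℕ.≤-reflexive (ℕ.+-identityʳ _))
                (ℕ.≤-trans (edgeList-degree G v) (subst (_≤ d) (sym (deg-P d v)) (degN-max d (toℕ v) (Fin.toℕ<n v))))
  ... | true  = begin
    degE v (edgeList G) + 1 ≤⟨ ℕ.+-monoˡ-≤ 1 (edgeList-degree G v) ⟩
    deg G v + 1             ≡⟨ cong (_+ 1) (midDegree (meets-mid (subst T (sym meets) _))) ⟩
    d₁ ∸ 1 + 1              ≤⟨ ℕ.+-monoˡ-≤ 1 (ℕ.m∸n≤m d₁ 1) ⟩
    d₁ + 1                  ≡⟨ ℕ.+-comm d₁ 1 ⟩
    d                       ∎
    where open ℕ.≤-Reasoning

  w-data : Σ ℕ λ w → Mid w × w ≢ toℕ p × w ≢ toℕ q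
  w-data = third mid-p mid-q (p≢q ∘ Fin.toℕ-injective)

  w : ℕ
  w = proj₁ w-data

  mid-w : Mid w
  mid-w = proj₁ (proj₂ w-data)

  wF : Fin (suc d)
  wF = fromℕ< (below9 (mid<9 mid-w))

  toℕ-wF : toℕ wF ≡ w
  toℕ-wF = Fin.toℕ-fromℕ< _

  degE-w : degE wF E ≤ d₁ ∸ 1
  degE-w rewrite degE-E wF with inc wF (p , q) in meets
  ... | false = ℕ.≤-trans (ℕ.≤-reflexive (ℕ.+-identityʳ _))
                (ℕ.≤-trans (edgeList-degree G wF) (ℕ.≤-reflexive (midDegree (subst Mid (sym toℕ-wF) mid-w))))
  ... | true with inc-ends {v = wF} {a = p} {b = q} (subst T (sym meets) _)
  ...   | inj₁ p≡w = ⊥-elim (proj₁ (proj₂ (proj₂ w-data)) (trans (sym toℕ-wF) (cong toℕ (sym p≡w))))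
  ...   | inj₂ q≡w = ⊥-elim (proj₂ (proj₂ (proj₂ w-data)) (trans (sym toℕ-wF) (cong toℕ (sym q≡w))))

  -- w has too small a degree to be a branch vertex …
  w-not-branch : ∀ c → φ c ≢ wF
  w-not-branch c φc≡w = ℕ.<-irrefl refl (ℕ.<-≤-trans (pred< d₁ (s≤s⁻¹ (ℕ.≤-trans (s≤s (s≤s z≤n)) 8≤d)))
                          (ℕ.≤-trans (branch-degree c) (subst (λ x → degE x E ≤ d₁ ∸ 1) (sym φc≡w) degE-w)))
    where
    pred< : ∀ n → 1 ≤ n → n ∸ 1 < n
    pred< (suc n) _ = ℕ.n<1+n n

  branch : ∀ u → u ≢ wF → ∃ λ c → φ c ≡ u
  branch = injection-misses-one φ φ-inj wF w-not-branch

  not-branch⇒w : ∀ z → (∀ c → φ c ≢ z) → z ≡ wF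
  not-branch⇒w z notBranch with z Fin.≟ wF
  ... | yes z≡w = z≡w
  ... | no  z≢w = ⊥-elim (notBranch (proj₁ (branch z z≢w)) (proj₂ (branch z z≢w)))

  E-nonAdjacent : ∀ x y → T (not (adj G x y)) → ¬ (Mid (toℕ x) × Mid (toℕ y)) → NonAdjacent x y
  E-nonAdjacent x y nonAdj notBothMid i joins with ∈-++⁻ (edgeList G) (∈-lookup {xs = E} i)
  ... | inj₁ inG = T-not⇒¬T nonAdj (adjacent (lookup E i) (edgeList-adj G inG) joins)
    where
    adjacent : ∀ e → T (adj G (proj₁ e) (proj₂ e)) → Joins e x y → T (adj G x y)
    adjacent e adj-e (inj₁ (refl , refl)) = adj-e
    adjacent e adj-e (inj₂ (refl , refl)) = subst T (SimpleGraph.sym G (proj₁ e) (proj₂ e)) adj-e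
  ... | inj₂ (here e≡pq) = newEdge (lookup E i) e≡pq joins
    where
    newEdge : ∀ e → e ≡ (p , q) → Joins e x y → ⊥
    newEdge _ refl (inj₁ (refl , refl)) = notBothMid (mid-p , mid-q)
    newEdge _ refl (inj₂ (refl , refl)) = notBothMid (mid-q , mid-p)

  labelSum : Visit wF → ℕ
  labelSum s = toℕ (φ (Visit.a s)) + toℕ (φ (Visit.b s))

  record Detour (pr : ℕ × ℕ) : Set where
    field
      visit : Visit wF
      sum≡  : labelSum visit ≡ key pr

  detour : ∀ {pr} → Forced d w pr → Detour pr
  detour {u₁ , u₂} (lt₁ , lt₂ , nonAdjP , notBothMid , u₁≢w , u₂≢w , u₁≢u₂) = record
    { visit = record { pair = o ; edges = subst (λ z → TwoEdgesAt z (route′ o)) z≡w twoEdges }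
    ; sum≡  = cong₂ _+_ (labelled lt₁ φc₁) (labelled lt₂ φc₂) }
    where
    labelled : ∀ {u c} (lt : u < suc d) → φ c ≡ fromℕ< lt → toℕ (φ c) ≡ u
    labelled lt φc≡ = trans (cong toℕ φc≡) (Fin.toℕ-fromℕ< lt)
    away : ∀ {u} (lt : u < suc d) → u ≢ w → fromℕ< lt ≢ wF
    away lt u≢w eq = u≢w (trans (sym (Fin.toℕ-fromℕ< lt)) (trans (cong toℕ eq) toℕ-wF))
    x₁ x₂ : Fin (suc d)
    x₁ = fromℕ< lt₁
    x₂ = fromℕ< lt₂
    c₁ c₂ : Fin d
    c₁ = proj₁ (branch x₁ (away lt₁ u₁≢w))
    c₂ = proj₁ (branch x₂ (away lt₂ u₂≢w))
    φc₁ : φ c₁ ≡ x₁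
    φc₁ = proj₂ (branch x₁ (away lt₁ u₁≢w))
    φc₂ : φ c₂ ≡ x₂
    φc₂ = proj₂ (branch x₂ (away lt₂ u₂≢w))
    o : OPair c₁ c₂
    o = orient λ c₁≡c₂ → u₁≢u₂ (trans (sym (labelled lt₁ φc₁)) (trans (cong (toℕ ∘ φ) c₁≡c₂) (labelled lt₂ φc₂)))
    nonAdjE : NonAdjacent (φ c₁) (φ c₂)
    nonAdjE = subst₂ NonAdjacent (sym φc₁) (sym φc₂) (E-nonAdjacent x₁ x₂
      (subst₂ (λ a b → T (not (adjN a b))) (sym (Fin.toℕ-fromℕ< lt₁)) (sym (Fin.toℕ-fromℕ< lt₂)) nonAdjP)
      (λ (m₁ , m₂) → notBothMid (subst Mid (Fin.toℕ-fromℕ< lt₁) m₁ , subst Mid (Fin.toℕ-fromℕ< lt₂) m₂)))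
    I : Interior (φ c₁) (φ c₂) (route′ o)
    I = route-interior o nonAdjE
    open Interior I
    z≡w : z ≡ wF
    z≡w = not-branch⇒w z (interior-not-branch maxDegE o I)

  sameSet⇒labelSum : ∀ {s t : Visit wF} → SameSet (Visit.a s) (Visit.b s) (Visit.a t) (Visit.b t) →
                     labelSum s ≡ labelSum t
  sameSet⇒labelSum (inj₁ (refl , refl)) = refl
  sameSet⇒labelSum {t = t} (inj₂ (refl , refl)) = ℕ.+-comm (toℕ (φ (Visit.b t))) (toℕ (φ (Visit.a t)))

  visitsOf : ∀ {xs} → All Detour xs → List (Visit wF)
  visitsOf []       = []
  visitsOf (r ∷ rs) = Detour.visit r ∷ visitsOf rs

  visits-different : ∀ {xs} (rs : All Detour xs) → Unique (map key xs) → AllPairs Different (visitsOf rs)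
  visits-different []       _                                = []
  visits-different {pr ∷ _} (r ∷ rs) (k∉ ∷ distinct) = differentFrom rs k∉ ∷ visits-different rs distinct
    where
    differentFrom : ∀ {xs} (rs : All Detour xs) → All (key pr ≢_) (map key xs) →
                    All (Different (Detour.visit r)) (visitsOf rs)
    differentFrom []         []         = []
    differentFrom (r′ ∷ rs′) (k≢ ∷ k∉′) = sameKey ∘ sameSet⇒labelSum {Detour.visit r} {Detour.visit r′} ∷ differentFrom rs′ k∉′
      where
      sameKey : labelSum (Detour.visit r) ≡ labelSum (Detour.visit r′) → ⊥
      sameKey same = k≢ (trans (sym (Detour.sum≡ r)) (trans same (Detour.sum≡ r′)))

  visitsOf-length : ∀ {xs} (rs : All Detour xs) → length (visitsOf rs) ≡ length xs
  visitsOf-length []       = refl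
  visitsOf-length (_ ∷ rs) = cong suc (visitsOf-length rs)

  -- the 4 + ⌊(d - 8)/2⌋ forced pairs need twice as many edges at w, more than d - 2
  impossible : ⊥
  impossible = ℕ.<-irrefl refl (ℕ.<-≤-trans tooFew (ℕ.≤-trans needed degE-w))
    where
    m : ℕ
    m = (d₁ ∸ 7) / 2
    d≡ : d ≡ 8 + (d₁ ∸ 7)
    d≡ = sym (ℕ.m+[n∸m]≡n 8≤d)
    xs : List (ℕ × ℕ)
    xs = forcedPairs w m
    rs : All Detour xs
    rs = All.map detour (forcedPairs-forced mid-w m 8≤d (subst (8 + m * 2 ≤_) (sym d≡) (ℕ.+-monoʳ-≤ 8 (proj₁ (halve (d₁ ∸ 7))))))
    needed : (4 + m) * 2 ≤ degE wF E
    needed = subst (λ n → n * 2 ≤ degE wF E) (trans (visitsOf-length rs) (forcedPairs-length mid-w m))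
               (visits-≤ (visitsOf rs) (visits-different rs (forcedPairs-keys mid-w m)))
    tooFew : d₁ ∸ 1 < (4 + m) * 2
    tooFew = begin-strict
      d₁ ∸ 1                ≡⟨ cong (_∸ 1) (ℕ.m+[n∸m]≡n (s≤s⁻¹ 8≤d)) ⟨
      6 + (d₁ ∸ 7)          ≤⟨ ℕ.+-monoʳ-≤ 6 (proj₂ (halve (d₁ ∸ 7))) ⟩
      7 + m * 2             <⟨ ℕ.n<1+n _ ⟩
      (4 + m) * 2           ∎
      where open ℕ.≤-Reasoning

record MiddlePair (d : ℕ) (M : List (Fin (suc d) × Fin (suc d))) : Set where
  field
    p q   : Fin (suc d)
    M≡pq  : M ≡ (p , q) ∷ []
    mid-p : Mid (toℕ p)
    mid-q : Mid (toℕ q)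
    p≢q   : p ≢ q

matching-single : ∀ {d M} → 8 ≤ d → MaxMatchingOnA d (P d) M → MiddlePair d M
matching-single {d} {M} 8≤d matching = single M (trans size (cong (_/ 2) countA-P)) inA disjoint
  where
  open PodDegrees d 8≤d
  open MaxMatchingOnA matching
  single : ∀ M → length M ≡ 1 → (∀ a b → (a , b) ∈ M → InA d (P d) a × InA d (P d) b) →
           Unique (pairVerts M) → MiddlePair d M
  single []                 ()
  single (_ ∷ _ ∷ _)        ()
  single ((p , q) ∷ []) _ inA ((p≢q ∷ _) ∷ _) = record
    { p = p ; q = q ; M≡pq = refl
    ; mid-p = inA⇒Mid p (proj₁ (inA p q (here refl))) ; mid-q = inA⇒Mid q (proj₂ (inA p q (here refl)))
    ; p≢q = p≢q }

lemma4p8 : (d : ℕ) → 8 ≤ d → IsPod d (P d)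
lemma4p8 zero     ()
lemma4p8 (suc d₁) 8≤d = record { minDeg = minDeg-P ; fewA = fewA-P ; noImm = noImmersion }
  where
  open PodDegrees (suc d₁) 8≤d
  noImmersion : ∀ M → MaxMatchingOnA (suc d₁) (P (suc d₁)) M → ¬ (K (suc d₁) immersedIn addPairs (P (suc d₁)) M)
  noImmersion M matching imm with matching-single 8≤d matching
  ... | record { M≡pq = refl ; mid-p = mid-p ; mid-q = mid-q ; p≢q = p≢q } =
    NoImmersion.impossible d₁ 8≤d mid-p mid-q p≢q imm
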